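{- Let $G$ be a simplicial clique covered graph (SCCG) with connection set $\mathcal{W}$, let $\mathbb{F}$ be a field and let $f:V(G)\to\mathbb{F}$ be a well-covered weighting of $G$. Let $w\in\mathcal{W}$. Then $f(w)=\sum_{C\in\overline{S}(\{w\})} f(v_C)$, where $\{v_C\}$ is a set of simplicial vertices with $v_C\in C$, one for each distinct $C\in\overline{S}(\{w\})$.
   Context: All graphs are finite, simple, connected and undirected. For $I\subseteq V(G)$, $N[I]$ is the closed neighborhood of $I$ (the vertices of $I$ together with all vertices adjacent to a vertex of $I$). A maximal independent set (MIS) is an independent set not properly contained in another independent set. A weighting $f:V(G)\to\mathbb{F}$ is well-covered if $\sum_{v\in\mathcal{M}}f(v)$ is the same for every MIS $\mathcal{M}$. A vertex $v$ is simplicial if $N[v]$ is a maximal clique. A simplicial clique is a maximal clique containing at least one simplicial vertex; $\mathcal{C}(G)$ is the set of simplicial cliques. $G$ is a SCCG if $\mathcal{C}(G)\neq\emptyset$ and the simplicial cliques cover $V(G)$. The connection set $\mathcal{W}$ is the set of vertices lying in at least two simplicial cliques. For an independent $I\subseteq\mathcal{W}$, $S(I)$ is the set of simplicial cliques not contained in $N[I]$, and $\overline{S}(I)=\mathcal{C}(G)\setminus S(I)$. -}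

module Defs where

open import Level using (Level; _⊔_) renaming (suc to lsuc)
open import Data.Nat using (ℕ; zero; suc)
open import Data.Fin using (Fin; zero; suc)
open import Data.Fin.Properties using (_≟_)
open import Data.Bool using (Bool; true; false; if_then_else_; _∨_)
open import Data.Vec using (Vec; tabulate; lookup)
open import Data.Fin.Subset using (Subset; _∈_; _⊆_; ⁅_⁆)
open import Data.List using (List; []; _∷_; foldr; map)
open import Data.Product using (Σ; ∃; ∃-syntax; _×_; _,_)
open import Data.Sum using (_⊎_)
open import Relation.Nullary using (¬_; does)
open import Relation.Binary.PropositionalEquality using (_≡_; _≢_)
open import Algebra.Bundles using (CommutativeRing)

record Field (c ℓ : Level) : Set (lsuc (c ⊔ ℓ)) where
  field
    commutativeRing : CommutativeRing c ℓ
  open CommutativeRing commutativeRing public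
  field
    1≉0     : ¬ (1# ≈ 0#)
    inverse : ∀ x → ¬ (x ≈ 0#) → ∃[ y ] (x * y ≈ 1#)

record Graph (n : ℕ) : Set where
  field
    adj     : Fin n → Fin n → Bool
    symm    : ∀ i j → adj i j ≡ adj j i
    irrefl  : ∀ i → adj i i ≡ false

module _ {n : ℕ} (G : Graph n) where
  open Graph G

  Adj : Fin n → Fin n → Set
  Adj i j = adj i j ≡ true

  data Reach : Fin n → Fin n → Set where
    here : ∀ {i} → Reach i i
    step : ∀ {i j k} → Adj i j → Reach j k → Reach i k

  Connected : Set
  Connected = ∀ i j → Reach i j

  Independent : Subset n → Set
  Independent S = ∀ i j → i ∈ S → j ∈ S → ¬ Adj i j

  MIS : Subset n → Set
  MIS S = Independent S × (∀ T → Independent T → S ⊆ T → T ⊆ S)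

  Clique : Subset n → Set
  Clique C = ∀ i j → i ∈ C → j ∈ C → i ≢ j → Adj i j

  MaximalClique : Subset n → Set
  MaximalClique C = Clique C × (∀ D → Clique D → C ⊆ D → D ⊆ C)

  N[_] : Fin n → Subset n
  N[ v ] = tabulate (λ u → does (u ≟ v) ∨ adj v u)

  InN[_] : Subset n → Fin n → Set
  InN[ I ] u = ∃[ i ] (i ∈ I × (u ≡ i ⊎ Adj i u))

  Simplicial : Fin n → Set
  Simplicial v = MaximalClique N[ v ]

  SimplicialClique : Subset n → Set
  SimplicialClique C = MaximalClique C × ∃[ v ] (v ∈ C × Simplicial v)

  SCCG : Set
  SCCG = (∃[ C ] SimplicialClique C)
       × (∀ v → ∃[ C ] (SimplicialClique C × v ∈ C))

  InConnectionSet : Fin n → Set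
  InConnectionSet w = ∃[ C ] ∃[ D ] (SimplicialClique C × SimplicialClique D
                                     × C ≢ D × w ∈ C × w ∈ D)

  InSbar : Subset n → Subset n → Set
  InSbar I C = SimplicialClique C × (∀ u → u ∈ C → InN[ I ] u)

module _ {c ℓ : Level} (F : Field c ℓ) where
  open Field F using (Carrier; _≈_; _+_; 0#)

  sumFin : ∀ {n} → (Fin n → Carrier) → Carrier
  sumFin {zero}  g = 0#
  sumFin {suc n} g = g zero + sumFin (λ i → g (suc i))

  sumOver : ∀ {n} → (Fin n → Carrier) → Subset n → Carrier
  sumOver f S = sumFin (λ i → if lookup S i then f i else 0#)

  sumList : List Carrier → Carrier
  sumList = foldr _+_ 0#

  WellCovered : ∀ {n} → Graph n → (Fin n → Carrier) → Set ℓ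
  WellCovered G f = ∀ M M' → MIS G M → MIS G M' → sumOver f M ≈ sumOver f M'

module Submission where

-- Extend {w} greedily to an independent dominating set M
-- (hence a MIS).  Let R = M - w and V = {v_C : C ∈ S̄({w})}.  Then
-- M' = R ∪ V is again an independent dominating set:
--  * every C ∈ S̄({w}) is N[v_C] and lies inside N[w], so v_C has no neighbour
--    in R (such a neighbour would be a neighbour of w in M), and two distinct
--    v_C are non-adjacent because a simplicial vertex lies in one maximal clique;
--  * a vertex x lies in some simplicial clique C with simplicial vertex s; if
--    w ∈ C then C ∈ S̄({w}) and v_C ∈ C dominates x, otherwise the vertex of M
--    dominating s lies in C, differs from w, and dominates x.

open import Defs
open import Level using (Level)
open import Data.Nat using (ℕ; zero; suc)
open import Data.Fin using (Fin; zero; suc)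
open import Data.Fin.Properties using (_≟_; any?)
open import Data.Fin.Subset using (Subset; _∈_; ⁅_⁆; _∪_; _─_; _-_; _⊆_; ⋃; inside)
  renaming (⊥ to ∅)
open import Data.Fin.Subset.Properties
  using (x∈⁅x⁆; x∈⁅y⁆⇒x≡y; x∈p∪q⁺; x∈p∪q⁻; ∉⊥; ⊆-antisym; x∈p∧x≢y⇒x∈p-y; p─q⊆p; p⊆p∪q; _∈?_)
open import Data.Vec using (_∷_; []; here; there)
open import Data.Vec.Properties using (lookup∘tabulate; lookup⇒[]=)
open import Data.Bool using (Bool; true; false; if_then_else_; _∨_)
import Data.Bool as Bool
open import Data.List using (List; []; _∷_; map; allFin)
open import Data.List.Properties using (map-∘)
open import Data.List.Relation.Unary.Unique.Propositional using (Unique)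
open import Data.List.Relation.Unary.AllPairs using ([]; _∷_)
import Data.List.Relation.Unary.All as All
open import Data.List.Relation.Unary.All.Properties using () renaming (map⁺ to All-map⁺)
import Data.List.Relation.Unary.Any as Any
import Data.List.Membership.Propositional as LM
open import Data.List.Membership.Propositional.Properties using (∈-allFin; ∈-map⁺; ∈-map⁻)
open import Data.Product using (Σ-syntax; ∃-syntax; _×_; _,_; proj₁; proj₂)
open import Data.Sum using (_⊎_; inj₁; inj₂; [_,_])
open import Data.Empty renaming (⊥ to Empty) using (⊥-elim)
open import Function using (_∘_; id)
open import Function.Bundles using (_⇔_; Equivalence)
open import Relation.Nullary using (¬_; Dec; yes; no; does; contradiction)
open import Relation.Nullary.Decidable using (_×-dec_; _⊎-dec_)
open import Relation.Binary.PropositionalEquality using (_≡_; _≢_; refl; sym; trans; cong; subst)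

Disjoint : ∀ {n} → Subset n → Subset n → Set
Disjoint p q = ∀ {x} → x ∈ p → x ∈ q → Empty

fromList : ∀ {n} → List (Fin n) → Subset n
fromList xs = ⋃ (map ⁅_⁆ xs)

∈fromList⁺ : ∀ {n} {x : Fin n} {xs} → x LM.∈ xs → x ∈ fromList xs
∈fromList⁺ {xs = y ∷ ys} (Any.here refl) = x∈p∪q⁺ (inj₁ (x∈⁅x⁆ y))
∈fromList⁺ {xs = y ∷ ys} (Any.there x∈ys) = x∈p∪q⁺ (inj₂ (∈fromList⁺ x∈ys))

∈fromList⁻ : ∀ {n} {x : Fin n} xs → x ∈ fromList xs → x LM.∈ xs
∈fromList⁻ []       x∈∅ = contradiction x∈∅ ∉⊥
∈fromList⁻ (y ∷ ys) x∈  with x∈p∪q⁻ ⁅ y ⁆ (fromList ys) x∈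
... | inj₁ x∈⁅y⁆ = Any.here (x∈⁅y⁆⇒x≡y y x∈⁅y⁆)
... | inj₂ x∈ys  = Any.there (∈fromList⁻ ys x∈ys)

─-disjoint : ∀ {n} (p q : Subset n) → Disjoint (p ─ q) q
─-disjoint (_ ∷ _) (inside ∷ _) () here
─-disjoint (_ ∷ p) (_ ∷ q) (there x∈) (there y∈) = ─-disjoint p q x∈ y∈

split-⁅⁆ : ∀ {n} {x : Fin n} {p} → x ∈ p → p ≡ ⁅ x ⁆ ∪ (p - x)
split-⁅⁆ {x = x} {p} x∈p = ⊆-antisym into onto
  where
  into : p ⊆ ⁅ x ⁆ ∪ (p - x)
  into {y} y∈p with y ≟ x
  ... | yes refl = x∈p∪q⁺ (inj₁ (x∈⁅x⁆ x))
  ... | no y≢x   = x∈p∪q⁺ (inj₂ (x∈p∧x≢y⇒x∈p-y y∈p y≢x))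
  onto : ⁅ x ⁆ ∪ (p - x) ⊆ p
  onto {y} y∈ with x∈p∪q⁻ ⁅ x ⁆ (p - x) y∈
  ... | inj₁ y∈⁅x⁆ = subst (_∈ p) (sym (x∈⁅y⁆⇒x≡y x y∈⁅x⁆)) x∈p
  ... | inj₂ y∈p-x = p─q⊆p p ⁅ x ⁆ y∈p-x

module Sums {c ℓ : Level} (F : Field c ℓ) where
  open Field F using (Carrier; _≈_; _+_; 0#; +-cong; +-congˡ; +-identityˡ; +-identityʳ; +-comm; setoid)
    renaming (refl to ≈-refl; sym to ≈-sym; trans to ≈-trans)
  open import Relation.Binary.Reasoning.Setoid setoid
  open import Algebra.Properties.CommutativeSemigroup (Field.+-commutativeSemigroup F) using (interchange)
  open import Algebra.Properties.AbelianGroup (Field.+-abelianGroup F) using (∙-cancelˡ)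

  sumOver-∅ : ∀ {n} (f : Fin n → Carrier) → sumOver F f ∅ ≈ 0#
  sumOver-∅ {zero}  f = ≈-refl
  sumOver-∅ {suc n} f = ≈-trans (+-identityˡ _) (sumOver-∅ (λ i → f (suc i)))

  sumOver-⁅⁆ : ∀ {n} (f : Fin n → Carrier) x → sumOver F f ⁅ x ⁆ ≈ f x
  sumOver-⁅⁆ f zero    = ≈-trans (+-congˡ (sumOver-∅ (λ i → f (suc i)))) (+-identityʳ _)
  sumOver-⁅⁆ f (suc x) = ≈-trans (+-identityˡ _) (sumOver-⁅⁆ (λ i → f (suc i)) x)

  term : Bool → Carrier → Carrier
  term b x = if b then x else 0#

  term-∨ : ∀ a b x → (a ≡ true → b ≡ true → Empty) → term (a ∨ b) x ≈ term a x + term b x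
  term-∨ true  true  x d = ⊥-elim (d refl refl)
  term-∨ true  false x _ = ≈-sym (+-identityʳ x)
  term-∨ false true  x _ = ≈-sym (+-identityˡ x)
  term-∨ false false x _ = ≈-sym (+-identityˡ 0#)

  sumOver-∪ : ∀ {n} (f : Fin n → Carrier) {p q : Subset n} → Disjoint p q
            → sumOver F f (p ∪ q) ≈ sumOver F f p + sumOver F f q
  sumOver-∪ f {[]}    {[]}    _ = ≈-sym (+-identityˡ 0#)
  sumOver-∪ f {a ∷ p} {b ∷ q} d = begin
    term (a ∨ b) (f zero) + sumOver F f' (p ∪ q)
      ≈⟨ +-cong (term-∨ a b (f zero) heads-disjoint) (sumOver-∪ f' tails-disjoint) ⟩
    (term a (f zero) + term b (f zero)) + (sumOver F f' p + sumOver F f' q)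
      ≈⟨ interchange _ _ _ _ ⟩
    (term a (f zero) + sumOver F f' p) + (term b (f zero) + sumOver F f' q) ∎
    where
    f' = λ i → f (suc i)
    heads-disjoint : a ≡ true → b ≡ true → Empty
    heads-disjoint refl refl = d here here
    tails-disjoint : Disjoint p q
    tails-disjoint x∈p x∈q = d (there x∈p) (there x∈q)

  sumOver-fromList : ∀ {n} (f : Fin n → Carrier) {xs} → Unique xs
                   → sumOver F f (fromList xs) ≈ sumList F (map f xs)
  sumOver-fromList f {[]}     []           = sumOver-∅ f
  sumOver-fromList f {x ∷ xs} (x∉xs ∷ uxs) = begin
    sumOver F f (⁅ x ⁆ ∪ fromList xs)          ≈⟨ sumOver-∪ f disjoint ⟩
    sumOver F f ⁅ x ⁆ + sumOver F f (fromList xs) ≈⟨ +-cong (sumOver-⁅⁆ f x) (sumOver-fromList f uxs) ⟩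
    f x + sumList F (map f xs)                 ∎
    where
    disjoint : Disjoint ⁅ x ⁆ (fromList xs)
    disjoint y∈⁅x⁆ y∈xs with x∈⁅y⁆⇒x≡y x y∈⁅x⁆
    ... | refl = All.lookup x∉xs (∈fromList⁻ xs y∈xs) refl

  cancel-common : ∀ a b c → a + b ≈ b + c → a ≈ c
  cancel-common a b c eq = ∙-cancelˡ b a c (≈-trans (+-comm b a) eq)

module GraphFacts {n : ℕ} (G : Graph n) where
  open Graph G using (adj; symm; irrefl)

  adj-sym : ∀ {i j} → Adj G i j → Adj G j i
  adj-sym {i} {j} a = trans (symm j i) a

  adj-irrefl : ∀ {i} → ¬ Adj G i i
  adj-irrefl {i} a with trans (sym a) (irrefl i)
  ... | ()

  adj? : ∀ i j → Dec (Adj G i j)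
  adj? i j = adj i j Bool.≟ true

  ∈N[]⁺ : ∀ {u v} → u ≡ v ⊎ Adj G v u → u ∈ N[ G ] v
  ∈N[]⁺ {u} {v} near = lookup⇒[]= u _ (trans (lookup∘tabulate _ u) (fold (u ≟ v) near))
    where
    fold : (d : Dec (u ≡ v)) → u ≡ v ⊎ Adj G v u → does d ∨ adj v u ≡ true
    fold (yes _)   _          = refl
    fold (no u≢v) (inj₁ u≡v) = contradiction u≡v u≢v
    fold (no _)   (inj₂ a)   = a

  clique-close : ∀ {C u x} → Clique G C → u ∈ C → x ∈ C → x ≡ u ⊎ Adj G u x
  clique-close {u = u} {x} cl u∈C x∈C with x ≟ u
  ... | yes x≡u = inj₁ x≡u
  ... | no x≢u  = inj₂ (cl u x u∈C x∈C (x≢u ∘ sym))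

  maxClique≡N[] : ∀ {C v} → MaximalClique G C → Simplicial G v → v ∈ C → C ≡ N[ G ] v
  maxClique≡N[] {C} {v} (cl , maxC) (clN , _) v∈C = ⊆-antisym C⊆N (maxC (N[ G ] v) clN C⊆N)
    where
    C⊆N : C ⊆ N[ G ] v
    C⊆N x∈C = ∈N[]⁺ (clique-close cl v∈C x∈C)

  simplicial-unique : ∀ {C D s} → MaximalClique G C → MaximalClique G D → Simplicial G s
                    → s ∈ C → s ∈ D → C ≡ D
  simplicial-unique mC mD simp s∈C s∈D =
    trans (maxClique≡N[] mC simp s∈C) (sym (maxClique≡N[] mD simp s∈D))

  adj-simplicial⇒∈ : ∀ {C s u} → MaximalClique G C → Simplicial G s → s ∈ C → Adj G s u → u ∈ C
  adj-simplicial⇒∈ mC simp s∈C a = subst (_ ∈_) (sym (maxClique≡N[] mC simp s∈C)) (∈N[]⁺ (inj₂ a))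

  Dominates : Subset n → Fin n → Set
  Dominates S x = InN[_] G S x

  meets-clique⇒dominates : ∀ {S C y x} → Clique G C → y ∈ S → y ∈ C → x ∈ C → Dominates S x
  meets-clique⇒dominates cl y∈S y∈C x∈C = _ , y∈S , clique-close cl y∈C x∈C

  dominates? : ∀ S x → Dec (Dominates S x)
  dominates? S x = any? λ i → (i ∈? S) ×-dec ((x ≟ i) ⊎-dec adj? i x)

  dominates-mono : ∀ {S T x} → S ⊆ T → Dominates S x → Dominates T x
  dominates-mono S⊆T (i , i∈S , near) = i , S⊆T i∈S , near

  dominating⇒MIS : ∀ {M} → Independent G M → (∀ x → Dominates M x) → MIS G M
  dominating⇒MIS {M} indM domM = indM , maximal
    where
    maximal : ∀ T → Independent G T → M ⊆ T → T ⊆ M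
    maximal T indT M⊆T {x} x∈T with domM x
    ... | i , i∈M , inj₁ refl = i∈M
    ... | i , i∈M , inj₂ a    = ⊥-elim (indT i x (M⊆T i∈M) x∈T a)

  ⁅⁆-independent : ∀ x → Independent G ⁅ x ⁆
  ⁅⁆-independent x i j i∈ j∈ a with x∈⁅y⁆⇒x≡y x i∈ | x∈⁅y⁆⇒x≡y x j∈
  ... | refl | refl = adj-irrefl a

  independent-add : ∀ {S x} → Independent G S → ¬ Dominates S x → Independent G (S ∪ ⁅ x ⁆)
  independent-add {S} {x} indS ¬dom i j i∈ j∈ a with x∈p∪q⁻ S ⁅ x ⁆ i∈ | x∈p∪q⁻ S ⁅ x ⁆ j∈
  ... | inj₁ i∈S | inj₁ j∈S = indS i j i∈S j∈S a
  ... | inj₁ i∈S | inj₂ j∈x with x∈⁅y⁆⇒x≡y x j∈x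
  ...   | refl = ¬dom (i , i∈S , inj₂ a)
  independent-add {S} {x} indS ¬dom i j i∈ j∈ a | inj₂ i∈x | inj₁ j∈S with x∈⁅y⁆⇒x≡y x i∈x
  ...   | refl = ¬dom (j , j∈S , inj₂ (adj-sym a))
  independent-add {S} {x} indS ¬dom i j i∈ j∈ a | inj₂ i∈x | inj₂ j∈x
    with x∈⁅y⁆⇒x≡y x i∈x | x∈⁅y⁆⇒x≡y x j∈x
  ...   | refl | refl = adj-irrefl a

  absorb : ∀ {S} → Independent G S → ∀ x
         → Σ[ S' ∈ Subset n ] (Independent G S' × S ⊆ S' × Dominates S' x)
  absorb {S} indS x with dominates? S x
  ... | yes dom  = S , indS , id , dom
  ... | no ¬dom  = S ∪ ⁅ x ⁆ , independent-add indS ¬dom , p⊆p∪q _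
                 , (x , x∈p∪q⁺ (inj₂ (x∈⁅x⁆ x)) , inj₁ refl)

  extend : (xs : List (Fin n)) → ∀ {S} → Independent G S
         → Σ[ M ∈ Subset n ] (Independent G M × S ⊆ M × (∀ {x} → x LM.∈ xs → Dominates M x))
  extend []       {S} indS = S , indS , id , λ ()
  extend (x ∷ xs)     indS with absorb indS x
  ... | S' , indS' , S⊆S' , domx with extend xs indS'
  ...   | M , indM , S'⊆M , domxs = M , indM , S'⊆M ∘ S⊆S' , dom
    where
    dom : ∀ {y} → y LM.∈ x ∷ xs → Dominates M y
    dom (Any.here refl) = dominates-mono S'⊆M domx
    dom (Any.there y∈xs) = domxs y∈xs

  extend-dominating : ∀ {I} → Independent G I
                    → Σ[ M ∈ Subset n ] (Independent G M × I ⊆ M × (∀ x → Dominates M x))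
  extend-dominating indI with extend (allFin n) indI
  ... | M , indM , I⊆M , dom = M , indM , I⊆M , λ x → dom (∈-allFin x)

module Exchange {n : ℕ} (G : Graph n)
  (cover : ∀ x → ∃[ C ] (SimplicialClique G C × x ∈ C))
  (w : Fin n) (Cs : List (Subset n))
  (Cs-spec : ∀ C → (InSbar G ⁅ w ⁆ C ⇔ C LM.∈ Cs))
  (v : Subset n → Fin n)
  (v-spec : ∀ C → C LM.∈ Cs → (v C ∈ C × Simplicial G (v C)))
  {M : Subset n} (indM : Independent G M) (domM : ∀ x → GraphFacts.Dominates G M x)
  (w∈M : w ∈ M)
  where
  open GraphFacts G

  Cs-maximal : ∀ {C} → C LM.∈ Cs → MaximalClique G C
  Cs-maximal {C} C∈Cs = proj₁ (proj₁ (Equivalence.from (Cs-spec C) C∈Cs))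

  Cs-near-w : ∀ {C u} → C LM.∈ Cs → u ∈ C → u ≡ w ⊎ Adj G w u
  Cs-near-w {C} C∈Cs u∈C with proj₂ (Equivalence.from (Cs-spec C) C∈Cs) _ u∈C
  ... | i , i∈⁅w⁆ , near with x∈⁅y⁆⇒x≡y w i∈⁅w⁆
  ...   | refl = near

  through-w⇒∈Cs : ∀ {C} → SimplicialClique G C → w ∈ C → C LM.∈ Cs
  through-w⇒∈Cs {C} sC w∈C = Equivalence.to (Cs-spec C)
    (sC , λ u u∈C → w , x∈⁅x⁆ w , clique-close (proj₁ (proj₁ sC)) w∈C u∈C)

  -- C = N[v_C], so neighbours of v_C lie in C.
  adj-v⇒∈ : ∀ {C u} → C LM.∈ Cs → Adj G (v C) u → u ∈ C
  adj-v⇒∈ {C} C∈Cs = adj-simplicial⇒∈ (Cs-maximal C∈Cs) (proj₂ (v-spec C C∈Cs)) (proj₁ (v-spec C C∈Cs))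

  -- If v_D lies in C (both in S̄({w})) then C = D: v_D lies in one maximal clique.
  v∈⇒≡ : ∀ {C D} → C LM.∈ Cs → D LM.∈ Cs → v D ∈ C → C ≡ D
  v∈⇒≡ {C} {D} C∈Cs D∈Cs vD∈C =
    simplicial-unique (Cs-maximal C∈Cs) (Cs-maximal D∈Cs) (proj₂ (v-spec D D∈Cs)) vD∈C (proj₁ (v-spec D D∈Cs))

  v-unique : ∀ {Ds} → (∀ {D} → D LM.∈ Ds → D LM.∈ Cs) → Unique Ds → Unique (map v Ds)
  v-unique {[]}     _   []           = []
  v-unique {D ∷ Ds} sub (D∉Ds ∷ uDs) =
    All-map⁺ (All.tabulate distinct) ∷ v-unique (sub ∘ Any.there) uDs
    where
    distinct : ∀ {E} → E LM.∈ Ds → v D ≢ v E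
    distinct E∈Ds vD≡vE = All.lookup D∉Ds E∈Ds
      (v∈⇒≡ (sub (Any.here refl)) (sub (Any.there E∈Ds))
            (subst (_∈ D) vD≡vE (proj₁ (v-spec D (sub (Any.here refl))))))

  M-far-from-w : ∀ {x} → x ∈ M → x ≢ w → ¬ (x ≡ w ⊎ Adj G w x)
  M-far-from-w x∈M x≢w (inj₁ x≡w) = x≢w x≡w
  M-far-from-w x∈M x≢w (inj₂ a)   = indM w _ w∈M x∈M a

  R V M' : Subset n
  R  = M - w
  V  = fromList (map v Cs)
  M' = R ∪ V

  ∈R⁻ : ∀ {x} → x ∈ R → x ∈ M × x ≢ w
  ∈R⁻ x∈R = p─q⊆p M ⁅ w ⁆ x∈R , λ { refl → ─-disjoint M ⁅ w ⁆ x∈R (x∈⁅x⁆ w) }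

  ∈V⁻ : ∀ {x} → x ∈ V → ∃[ C ] (C LM.∈ Cs × x ≡ v C)
  ∈V⁻ x∈V = ∈-map⁻ v (∈fromList⁻ (map v Cs) x∈V)

  v∈M' : ∀ {C} → C LM.∈ Cs → v C ∈ M'
  v∈M' C∈Cs = x∈p∪q⁺ (inj₂ (∈fromList⁺ (∈-map⁺ v C∈Cs)))

  R⊆M' : ∀ {x} → x ∈ M → x ≢ w → x ∈ M'
  R⊆M' x∈M x≢w = x∈p∪q⁺ (inj₁ (x∈p∧x≢y⇒x∈p-y x∈M x≢w))

  ⁅w⁆-R-disjoint : Disjoint ⁅ w ⁆ R
  ⁅w⁆-R-disjoint x∈⁅w⁆ x∈R = proj₂ (∈R⁻ x∈R) (x∈⁅y⁆⇒x≡y w x∈⁅w⁆)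

  R-V-disjoint : Disjoint R V
  R-V-disjoint x∈R x∈V with ∈R⁻ x∈R | ∈V⁻ x∈V
  ... | x∈M , x≢w | C , C∈Cs , refl =
    M-far-from-w x∈M x≢w (Cs-near-w C∈Cs (proj₁ (v-spec C C∈Cs)))

  -- A vertex of R adjacent to some v_D would lie in D ⊆ N[w].
  R-V-independent : ∀ {x D} → x ∈ R → D LM.∈ Cs → ¬ Adj G (v D) x
  R-V-independent x∈R D∈Cs a with ∈R⁻ x∈R
  ... | x∈M , x≢w = M-far-from-w x∈M x≢w (Cs-near-w D∈Cs (adj-v⇒∈ D∈Cs a))

  -- Adjacent v_C, v_D would force C = D and a loop at v_C.
  V-independent : ∀ {C D} → C LM.∈ Cs → D LM.∈ Cs → ¬ Adj G (v C) (v D)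
  V-independent C∈Cs D∈Cs a with v∈⇒≡ C∈Cs D∈Cs (adj-v⇒∈ C∈Cs a)
  ... | refl = adj-irrefl a

  M'-independent : Independent G M'
  M'-independent i j i∈ j∈ a with x∈p∪q⁻ R V i∈ | x∈p∪q⁻ R V j∈
  ... | inj₁ i∈R | inj₁ j∈R = indM i j (proj₁ (∈R⁻ i∈R)) (proj₁ (∈R⁻ j∈R)) a
  ... | inj₁ i∈R | inj₂ j∈V with ∈V⁻ j∈V
  ...   | D , D∈Cs , refl = R-V-independent i∈R D∈Cs (adj-sym a)
  M'-independent i j i∈ j∈ a | inj₂ i∈V | inj₁ j∈R with ∈V⁻ i∈V
  ...   | C , C∈Cs , refl = R-V-independent j∈R C∈Cs a
  M'-independent i j i∈ j∈ a | inj₂ i∈V | inj₂ j∈V with ∈V⁻ i∈V | ∈V⁻ j∈V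
  ...   | C , C∈Cs , refl | D , D∈Cs , refl = V-independent C∈Cs D∈Cs a

  -- Each vertex x lies in a simplicial clique C; M' meets C.
  M'-dominating : ∀ x → Dominates M' x
  M'-dominating x with cover x
  ... | C , sC@((cl , _) , s , s∈C , simp) , x∈C with w ∈? C
  ...   | yes w∈C = meets-clique⇒dominates cl (v∈M' C∈Cs) (proj₁ (v-spec C C∈Cs)) x∈C
    where C∈Cs = through-w⇒∈Cs sC w∈C
  ...   | no w∉C with domM s
  ...     | y , y∈M , near = meets-clique⇒dominates cl (R⊆M' y∈M y≢w) y∈C x∈C
    where
    -- y ∈ N[s] = C
    y∈C : y ∈ C
    y∈C = [ (λ s≡y → subst (_∈ C) s≡y s∈C)
          , (λ a → adj-simplicial⇒∈ (proj₁ sC) simp s∈C (adj-sym a)) ] near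
    y≢w : y ≢ w
    y≢w refl = w∉C y∈C

  M'-MIS : MIS G M'
  M'-MIS = dominating⇒MIS M'-independent M'-dominating

mainTheorem3 : ∀ {c ℓ : Level} (F : Field c ℓ) {n : ℕ} (G : Graph n)
    → Connected G → SCCG G
    → (f : Fin n → Field.Carrier F) → WellCovered F G f
    → (w : Fin n) → InConnectionSet G w
    → (Cs : List (Subset n)) → Unique Cs
    → (∀ C → (InSbar G ⁅ w ⁆ C ⇔ LM._∈_ C Cs))
    → (v : Subset n → Fin n)
    → (∀ C → LM._∈_ C Cs → (v C ∈ C × Simplicial G (v C)))
    → Field._≈_ F (f w) (sumList F (map (λ C → f (v C)) Cs))
mainTheorem3 F G _ (_ , cover) f wc w _ Cs Cs-unique Cs-spec v v-spec
  with GraphFacts.extend-dominating G (GraphFacts.⁅⁆-independent G w)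
... | M , indM , ⁅w⁆⊆M , domM = cancel-common (f w) (sumOver F f R) _ (begin
    f w + sumOver F f R                         ≈⟨ +-congʳ (sumOver-⁅⁆ f w) ⟨
    sumOver F f ⁅ w ⁆ + sumOver F f R           ≈⟨ sumOver-∪ f ⁅w⁆-R-disjoint ⟨
    sumOver F f (⁅ w ⁆ ∪ R)                     ≡⟨ cong (sumOver F f) (split-⁅⁆ w∈M) ⟨
    sumOver F f M                               ≈⟨ wc M M' (dominating⇒MIS indM domM) M'-MIS ⟩
    sumOver F f (R ∪ V)                         ≈⟨ sumOver-∪ f R-V-disjoint ⟩
    sumOver F f R + sumOver F f V               ≈⟨ +-congˡ (sumOver-fromList f (v-unique id Cs-unique)) ⟩
    sumOver F f R + sumList F (map f (map v Cs)) ≡⟨ cong (λ xs → sumOver F f R + sumList F xs) (map-∘ Cs) ⟨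
    sumOver F f R + sumList F (map (λ C → f (v C)) Cs) ∎)
  where
  open Field F using (_+_; +-congˡ; +-congʳ; setoid)
  open import Relation.Binary.Reasoning.Setoid setoid
  open Sums F
  open GraphFacts G
  w∈M : w ∈ M
  w∈M = ⁅w⁆⊆M (x∈⁅x⁆ w)
  open Exchange G cover w Cs Cs-spec v v-spec indM domM w∈M
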